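{- Let $G$ be a graph embedded on an orientable surface without boundary such that every face is homeomorphic to an open disc and every edge lies on the boundary of two distinct faces, let $\alpha$ be strongly connected, let $\mathcal F=\{F_1,\dots,F_{|\mathcal F|}\}$ be the facial circuits, and let $\mathbf D(\emptyset)$, $\mathbf E_i$ and $\mathbf c$ be as described below. For any $I\subseteq\{1,2,\dots,|\mathcal F|\}$, the restriction of $\mathbf c$ to the directed graph $\mathbf D(\emptyset)-\bigcup_{i\in I}\mathbf E_i$ (obtained by deleting all edges in $\bigcup_{i\in I}\mathbf E_i$) is both a U-coloring and an L-coloring.
   Context: Under the embedding assumptions, each face is bounded by a circuit (facial circuit), and every edge lies on exactly two distinct facial circuits. For $\alpha:V(G)\to\mathbb Z_{\ge 0}$, an $\alpha$-orientation is an orientation of $G$ in which every vertex $v$ has out-degree $\alpha(v)$; $\alpha$ is strongly connected if (some, equivalently every) $\alpha$-orientation is strongly connected. A directed facial circuit is counterclockwise (ccw) if, traversing it along its direction, its face lies to the left. A flip on a ccw facial circuit $F$ reverses the direction of all edges of $F$ (making it clockwise). $\mathbf D(\emptyset)$ is the directed graph whose vertices are all $\alpha$-orientations of $G$, with a directed edge from $D'$ to $D$ whenever $D$ is obtained from $D'$ by a flip; such an edge has type $F_i$ if the flip is on $F_i$, $\mathbf E_i$ is the set of edges of type $F_i$, and $\mathbf c(\mathbf e)=i$ for $\mathbf e\in\mathbf E_i$. For a digraph with edge coloring $c$, where $(u,v)$ denotes an edge from $u$ to $v$: $c$ is a U-coloring if for all vertices $u,v,w$ with $u\ne w$ and edges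 $(v,u),(v,w)$: (U1) $c(v,u)\ne c(v,w)$, and (U2) there is a vertex $z$ and edges $(u,z),(w,z)$ with $c(v,u)=c(w,z)$ and $c(v,w)=c(u,z)$. An L-coloring is defined identically with every edge $(i,j)$ in this definition replaced by $(j,i)$. -}

module Defs where

open import Data.Nat using (ℕ; zero; suc)
open import Data.Bool using (Bool; true; false; not; if_then_else_)
open import Data.Fin using (Fin; _≟_)
open import Data.Fin.Subset using (Subset; _∉_)
open import Data.Vec using (Vec; lookup; tabulate; allFin)
open import Data.Vec.Relation.Unary.Any using ()
open import Data.List using (List; length; filter)
import Data.Vec as V
open import Data.Product using (Σ; ∃; _×_; _,_; proj₁; proj₂)
open import Data.Sum using (_⊎_)
open import Relation.Nullary using (does; ¬_; Dec; yes; no; _⊎-dec_)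
open import Relation.Binary.PropositionalEquality using (_≡_; _≢_)

iter : {A : Set} → (A → A) → ℕ → A → A
iter f zero    x = x
iter f (suc j) x = f (iter f j x)

-- A graph (loops / multiple edges allowed) with vertices Fin n and edges Fin m,
-- each edge e having a reference direction tail e → head e, cellularly embedded on
-- an orientable closed surface, encoded (Heffter–Edmonds) by a rotation system.
-- Darts: (e , true) runs tail e → head e, (e , false) runs head e → tail e.
Dart : ℕ → Set
Dart m = Fin m × Bool

rev : {m : ℕ} → Dart m → Dart m
rev (e , b) = (e , not b)

dsource : {n m : ℕ} → (Fin m → Fin n) → (Fin m → Fin n) → Dart m → Fin n
dsource tl hd (e , true)  = tl e
dsource tl hd (e , false) = hd e

record EmbeddedGraph : Set where
  field
    n m k : ℕ
    tail head : Fin m → Fin n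
    -- ρ : clockwise successor of a dart around its source vertex (a permutation
    -- whose cycles are exactly the sets of darts at each vertex)
    ρ ρ⁻¹ : Dart m → Dart m
    ρ-inv₁ : ∀ d → ρ⁻¹ (ρ d) ≡ d
    ρ-inv₂ : ∀ d → ρ (ρ⁻¹ d) ≡ d
    ρ-source : ∀ d → dsource tail head (ρ d) ≡ dsource tail head d
    ρ-transitive : ∀ d d' → dsource tail head d ≡ dsource tail head d' → ∃ λ j → iter ρ j d ≡ d'
    face : Dart m → Fin k
    -- face permutation φ d = ρ (rev d): the dart following d on the face lying to its left
    face-φ : ∀ d → face (ρ (rev d)) ≡ face d
    face-orbit : ∀ d d' → face d ≡ face d' → ∃ λ j → iter (λ x → ρ (rev x)) j d ≡ d'
    face-onto : ∀ (i : Fin k) → ∃ λ d → face d ≡ i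
    two-faces : ∀ d → face d ≢ face (rev d)
    facial-circuit : ∀ d d' → face d ≡ face d' → dsource tail head d ≡ dsource tail head d' → d ≡ d'

module _ (G : EmbeddedGraph) where
  open EmbeddedGraph G

  source : Dart m → Fin n
  source = dsource tail head

  Orientation : Set
  Orientation = Vec Bool m

  dartOf : Orientation → Fin m → Dart m
  dartOf O e = (e , lookup O e)

  outdeg : Orientation → Fin n → ℕ
  outdeg O v = length (filter (λ e → source (dartOf O e) ≟ v) (V.toList (allFin m)))

  IsαOrientation : (Fin n → ℕ) → Orientation → Set
  IsαOrientation α O = ∀ v → outdeg O v ≡ α v

  data Reach (O : Orientation) : Fin n → Fin n → Set where
    here  : ∀ {u} → Reach O u u
    step  : ∀ {u w} e → source (dartOf O e) ≡ u → Reach O (source (rev (dartOf O e))) w → Reach O u w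

  StronglyConnectedOrientation : Orientation → Set
  StronglyConnectedOrientation O = ∀ u v → Reach O u v

  StronglyConnectedα : (Fin n → ℕ) → Set
  StronglyConnectedα α = ∀ O → IsαOrientation α O → StronglyConnectedOrientation O

  -- face i is a ccw directed facial circuit in O: every edge of F_i is directed
  -- along the boundary walk of F_i that has F_i on its left
  IsCCW : Orientation → Fin k → Set
  IsCCW O i = ∀ d → face d ≡ i → dartOf O (proj₁ d) ≡ d

  onFace? : (e : Fin m) (i : Fin k) → Dec ((face (e , true) ≡ i) ⊎ (face (e , false) ≡ i))
  onFace? e i = (face (e , true) ≟ i) ⊎-dec (face (e , false) ≟ i)

  flip : Orientation → Fin k → Orientation
  flip O i = tabulate λ e → if does (onFace? e i) then not (lookup O e) else lookup O e

  DEdge : (Fin n → ℕ) → Orientation → Orientation → Fin k → Set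
  DEdge α O' O i = IsαOrientation α O' × IsαOrientation α O × IsCCW O' i × O ≡ flip O' i

  -- D(∅) − ⋃_{i ∈ I} E_i, with coloring c
  DEdgeMinus : (Fin n → ℕ) → Subset k → Orientation → Orientation → Fin k → Set
  DEdgeMinus α I O' O i = DEdge α O' O i × i ∉ I

-- Edge-coloured digraphs given as a relation E x y c : "there is an edge (x,y) of colour c".
IsUColoring : {V C : Set} → (V → V → C → Set) → Set
IsUColoring {V} {C} E =
  ∀ (u v w : V) (c₁ c₂ : C) → u ≢ w → E v u c₁ → E v w c₂ →
    (c₁ ≢ c₂) × (∃ λ z → E u z c₂ × E w z c₁)

IsLColoring : {V C : Set} → (V → V → C → Set) → Set
IsLColoring E = IsUColoring (λ x y c → E y x c)

-- Two edges of D(∅) leaving the same orientation O are flips of two distinct faces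
-- that are both counterclockwise in O.  Such faces share no edge: a common edge would
-- have to point along the boundary walks of both faces, hence along the same dart,
-- which lies on only one face.  Flips of edge-disjoint faces commute, leave each other's
-- direction intact, and change out-degrees independently, so flipping both faces gives
-- the fourth corner of the required square.  Edges entering a common orientation are
-- handled in the same way, with both faces clockwise.
module Submission where

open import Defs
open import Data.Nat using (ℕ; _+_)
open import Data.Nat.Properties using (+-comm; +-cancelʳ-≡; +-commutativeSemigroup)
open import Algebra.Properties.CommutativeSemigroup +-commutativeSemigroup using (interchange)
open import Data.Bool using (Bool; true; false; not; if_then_else_; _xor_)
open import Data.Bool.Properties using (not-involutive; xor-assoc; xor-comm; xor-same)
open import Data.Fin using (Fin; _≟_)
open import Data.Fin.Subset using (Subset; _∉_)
open import Data.List using (List; []; _∷_; length; filter)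
open import Data.Vec using (lookup; toList; allFin)
open import Data.Vec.Properties using (lookup∘tabulate)
open import Data.Vec.Relation.Binary.Pointwise.Extensional using (ext; Pointwise-≡⇒≡)
open import Data.Product using (_×_; _,_; proj₁; ∃)
open import Data.Sum using (_⊎_; inj₁; inj₂)
open import Relation.Nullary using (Dec; does; yes; no; ¬_)
open import Relation.Nullary.Decidable using (dec-true; dec-false)
open import Relation.Binary.PropositionalEquality

indicator : {P : Set} → Dec P → ℕ
indicator P? = if does P? then 1 else 0

length-filter-∷ : {A : Set} {P : A → Set} (P? : ∀ x → Dec (P x)) (x : A) (xs : List A) →
  length (filter P? (x ∷ xs)) ≡ indicator (P? x) + length (filter P? xs)
length-filter-∷ P? x xs with P? x
... | yes _ = refl
... | no _  = refl

-- The hypothesis says that {f x, g x} and {h x, k x} agree as multisets.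
length-filter-interchange : {A B : Set} {P : B → Set} (P? : ∀ b → Dec (P b)) (f g h k : A → B) →
  (∀ x → (f x ≡ h x × g x ≡ k x) ⊎ (f x ≡ k x × g x ≡ h x)) → (xs : List A) →
  length (filter (λ x → P? (f x)) xs) + length (filter (λ x → P? (g x)) xs)
    ≡ length (filter (λ x → P? (h x)) xs) + length (filter (λ x → P? (k x)) xs)
length-filter-interchange P? f g h k same [] = refl
length-filter-interchange P? f g h k same (x ∷ xs) = begin
  length (filter (λ x → P? (f x)) (x ∷ xs)) + length (filter (λ x → P? (g x)) (x ∷ xs))
    ≡⟨ cong₂ _+_ (unfold f) (unfold g) ⟩
  (ind f + count f) + (ind g + count g)  ≡⟨ interchange (ind f) (count f) (ind g) (count g) ⟩
  (ind f + ind g) + (count f + count g)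
    ≡⟨ cong₂ _+_ (head (same x)) (length-filter-interchange P? f g h k same xs) ⟩
  (ind h + ind k) + (count h + count k)  ≡⟨ interchange (ind h) (ind k) (count h) (count k) ⟩
  (ind h + count h) + (ind k + count k)
    ≡⟨ sym (cong₂ _+_ (unfold h) (unfold k)) ⟩
  length (filter (λ x → P? (h x)) (x ∷ xs)) + length (filter (λ x → P? (k x)) (x ∷ xs)) ∎
  where
  open ≡-Reasoning
  ind : (_ → _) → ℕ
  ind φ = indicator (P? (φ x))
  count : (_ → _) → ℕ
  count φ = length (filter (λ x → P? (φ x)) xs)
  unfold : ∀ φ → length (filter (λ x → P? (φ x)) (x ∷ xs)) ≡ ind φ + count φ
  unfold φ = length-filter-∷ (λ y → P? (φ y)) x xs
  head : (f x ≡ h x × g x ≡ k x) ⊎ (f x ≡ k x × g x ≡ h x) → ind f + ind g ≡ ind h + ind k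
  head (inj₁ (fh , gk)) = cong₂ (λ a b → indicator (P? a) + indicator (P? b)) fh gk
  head (inj₂ (fk , gh)) =
    trans (cong₂ (λ a b → indicator (P? a) + indicator (P? b)) fk gh) (+-comm (ind k) (ind h))

if-not≡xor : ∀ c b → (if c then not b else b) ≡ c xor b
if-not≡xor true  b = refl
if-not≡xor false b = refl

module _ (G : EmbeddedGraph) where
  open EmbeddedGraph G

  OnFace : Fin m → Fin k → Set
  OnFace e i = (face (e , true) ≡ i) ⊎ (face (e , false) ≡ i)

  onFace : ∀ {d i} → face d ≡ i → OnFace (proj₁ d) i
  onFace {_ , true}  d∈i = inj₁ d∈i
  onFace {_ , false} d∈i = inj₂ d∈i

  onFace-dart : ∀ {e i} → OnFace e i → ∃ λ b → face (e , b) ≡ i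
  onFace-dart (inj₁ d∈i) = true , d∈i
  onFace-dart (inj₂ d∈i) = false , d∈i

  EdgeDisjoint : Fin k → Fin k → Set
  EdgeDisjoint i j = ∀ e → OnFace e i → ¬ OnFace e j

  edgeDisjoint-sym : ∀ {i j} → EdgeDisjoint i j → EdgeDisjoint j i
  edgeDisjoint-sym disj e e∈j e∈i = disj e e∈i e∈j

  IsCW : Orientation G → Fin k → Set
  IsCW O i = ∀ d → face d ≡ i → dartOf G O (proj₁ d) ≡ rev d

  rev-involutive : ∀ (d : Dart m) → rev (rev d) ≡ d
  rev-involutive (e , b) = cong (e ,_) (not-involutive b)

  lookup-flip : ∀ O i e → lookup (flip G O i) e ≡ does (onFace? G e i) xor lookup O e
  lookup-flip O i e = trans (lookup∘tabulate _ e) (if-not≡xor (does (onFace? G e i)) (lookup O e))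

  dartOf-flip-on : ∀ O {i e} → OnFace e i → dartOf G (flip G O i) e ≡ rev (dartOf G O e)
  dartOf-flip-on O {i} {e} e∈i =
    cong (e ,_) (trans (lookup-flip O i e) (cong (_xor lookup O e) (dec-true (onFace? G e i) e∈i)))

  dartOf-flip-off : ∀ O {i e} → ¬ OnFace e i → dartOf G (flip G O i) e ≡ dartOf G O e
  dartOf-flip-off O {i} {e} e∉i =
    cong (e ,_) (trans (lookup-flip O i e) (cong (_xor lookup O e) (dec-false (onFace? G e i) e∉i)))

  flip-involutive : ∀ O i → flip G (flip G O i) i ≡ O
  flip-involutive O i = Pointwise-≡⇒≡ (ext λ e → begin
    lookup (flip G (flip G O i) i) e  ≡⟨ lookup-flip (flip G O i) i e ⟩
    c e xor lookup (flip G O i) e     ≡⟨ cong (c e xor_) (lookup-flip O i e) ⟩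
    c e xor (c e xor lookup O e)      ≡⟨ sym (xor-assoc (c e) (c e) (lookup O e)) ⟩
    (c e xor c e) xor lookup O e      ≡⟨ cong (_xor lookup O e) (xor-same (c e)) ⟩
    lookup O e                        ∎)
    where
    open ≡-Reasoning
    c : Fin m → Bool
    c e = does (onFace? G e i)

  flip-comm : ∀ O i j → flip G (flip G O i) j ≡ flip G (flip G O j) i
  flip-comm O i j = Pointwise-≡⇒≡ (ext λ e → begin
    lookup (flip G (flip G O i) j) e  ≡⟨ lookup-flip (flip G O i) j e ⟩
    c j e xor lookup (flip G O i) e   ≡⟨ cong (c j e xor_) (lookup-flip O i e) ⟩
    c j e xor (c i e xor lookup O e)  ≡⟨ sym (xor-assoc (c j e) (c i e) (lookup O e)) ⟩
    (c j e xor c i e) xor lookup O e  ≡⟨ cong (_xor lookup O e) (xor-comm (c j e) (c i e)) ⟩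
    (c i e xor c j e) xor lookup O e  ≡⟨ xor-assoc (c i e) (c j e) (lookup O e) ⟩
    c i e xor (c j e xor lookup O e)  ≡⟨ cong (c i e xor_) (sym (lookup-flip O j e)) ⟩
    c i e xor lookup (flip G O j) e   ≡⟨ sym (lookup-flip (flip G O j) i e) ⟩
    lookup (flip G (flip G O j) i) e  ∎)
    where
    open ≡-Reasoning
    c : Fin k → Fin m → Bool
    c l e = does (onFace? G e l)

  ccw-flip : ∀ O {i} → IsCCW G O i → IsCW (flip G O i) i
  ccw-flip O ccw d d∈i = trans (dartOf-flip-on O (onFace d∈i)) (cong rev (ccw d d∈i))

  cw-flip : ∀ O {i} → IsCW O i → IsCCW G (flip G O i) i
  cw-flip O {i} cw d d∈i = begin
    dartOf G (flip G O i) (proj₁ d)  ≡⟨ dartOf-flip-on O (onFace d∈i) ⟩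
    rev (dartOf G O (proj₁ d))       ≡⟨ cong rev (cw d d∈i) ⟩
    rev (rev d)                      ≡⟨ rev-involutive d ⟩
    d                                ∎
    where open ≡-Reasoning

  ccw-flip-disjoint : ∀ O {i j} → EdgeDisjoint i j → IsCCW G O i → IsCCW G (flip G O j) i
  ccw-flip-disjoint O disj ccw d d∈i = trans (dartOf-flip-off O (disj _ (onFace d∈i))) (ccw d d∈i)

  cw-flip-disjoint : ∀ O {i j} → EdgeDisjoint i j → IsCW O i → IsCW (flip G O j) i
  cw-flip-disjoint O disj cw d d∈i = trans (dartOf-flip-off O (disj _ (onFace d∈i))) (cw d d∈i)

  -- τ d is the dart along which O orients the edge of a dart d of face i or j:
  -- d itself for counterclockwise faces, rev d for clockwise ones.
  edgeDisjoint-by-dart : ∀ {i j} (τ : Dart m → Dart m) → (∀ {d d'} → τ d ≡ τ d' → d ≡ d') →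
    (O : Orientation G) → (∀ d → face d ≡ i → dartOf G O (proj₁ d) ≡ τ d) →
    (∀ d → face d ≡ j → dartOf G O (proj₁ d) ≡ τ d) → i ≢ j → EdgeDisjoint i j
  edgeDisjoint-by-dart τ τ-injective O dir-i dir-j i≢j e e∈i e∈j
    with b , d∈i ← onFace-dart e∈i | b' , d'∈j ← onFace-dart e∈j
    with refl ← τ-injective (trans (sym (dir-i (e , b) d∈i)) (dir-j (e , b') d'∈j))
    = i≢j (trans (sym d∈i) d'∈j)

  ccw-disjoint : ∀ O {i j} → IsCCW G O i → IsCCW G O j → i ≢ j → EdgeDisjoint i j
  ccw-disjoint O = edgeDisjoint-by-dart (λ d → d) (λ d≡d' → d≡d') O

  cw-disjoint : ∀ O {i j} → IsCW O i → IsCW O j → i ≢ j → EdgeDisjoint i j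
  cw-disjoint O = edgeDisjoint-by-dart rev rev-injective O
    where
    rev-injective : ∀ {d d'} → rev d ≡ rev d' → d ≡ d'
    rev-injective {d} {d'} eq = trans (sym (rev-involutive d)) (trans (cong rev eq) (rev-involutive d'))

  flip-square-outdeg : ∀ {i j} → EdgeDisjoint i j → (O : Orientation G) (v : Fin n) →
    outdeg G (flip G (flip G O i) j) v + outdeg G O v ≡ outdeg G (flip G O i) v + outdeg G (flip G O j) v
  flip-square-outdeg {i} {j} disj O v =
    length-filter-interchange (λ d → source G d ≟ v)
      (dartOf G Oᵢⱼ) (dartOf G O) (dartOf G Oᵢ) (dartOf G Oⱼ) corners (toList (allFin m))
    where
    Oᵢ = flip G O i
    Oⱼ = flip G O j
    Oᵢⱼ = flip G Oᵢ j
    corners : ∀ e → (dartOf G Oᵢⱼ e ≡ dartOf G Oᵢ e × dartOf G O e ≡ dartOf G Oⱼ e)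
                  ⊎ (dartOf G Oᵢⱼ e ≡ dartOf G Oⱼ e × dartOf G O e ≡ dartOf G Oᵢ e)
    corners e with onFace? G e i
    ... | yes e∈i = inj₁ (dartOf-flip-off Oᵢ (disj e e∈i) , sym (dartOf-flip-off O (disj e e∈i)))
    ... | no e∉i  = inj₂ ( trans (cong (λ O' → dartOf G O' e) (flip-comm O i j)) (dartOf-flip-off Oⱼ e∉i)
                         , sym (dartOf-flip-off O e∉i))

  flip-square-α : ∀ {α} O {i j} → EdgeDisjoint i j → IsαOrientation G α O →
    IsαOrientation G α (flip G O i) → IsαOrientation G α (flip G O j) →
    IsαOrientation G α (flip G (flip G O i) j)
  flip-square-α {α} O {i} {j} disj αO αOi αOj v = +-cancelʳ-≡ (outdeg G O v) _ _ (begin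
    outdeg G (flip G (flip G O i) j) v + outdeg G O v  ≡⟨ flip-square-outdeg disj O v ⟩
    outdeg G (flip G O i) v + outdeg G (flip G O j) v  ≡⟨ cong₂ _+_ (αOi v) (αOj v) ⟩
    α v + α v                                          ≡⟨ cong (α v +_) (sym (αO v)) ⟩
    α v + outdeg G O v                                 ∎)
    where open ≡-Reasoning

  flip-swap : ∀ {O O' i} → O' ≡ flip G O i → O ≡ flip G O' i
  flip-swap {O} {i = i} refl = sym (flip-involutive O i)

  flip-target-cw : ∀ O {O' i} → O' ≡ flip G O i → IsCCW G O i → IsCW O' i
  flip-target-cw O refl = ccw-flip O

  module _ (α : Fin n → ℕ) (I : Subset k) where

    ccw-square : ∀ O {i j} → IsαOrientation G α O → IsαOrientation G α (flip G O i) →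
      IsαOrientation G α (flip G O j) → IsCCW G O i → IsCCW G O j → i ≢ j → i ∉ I → j ∉ I →
      ∃ λ O' → DEdgeMinus G α I (flip G O i) O' j × DEdgeMinus G α I (flip G O j) O' i
    ccw-square O {i} {j} αO αOi αOj ccw-i ccw-j i≢j i∉I j∉I =
      flip G (flip G O i) j ,
      ((αOi , αO' , ccw-flip-disjoint O (edgeDisjoint-sym disj) ccw-j , refl) , j∉I) ,
      ((αOj , αO' , ccw-flip-disjoint O disj ccw-i , flip-comm O i j) , i∉I)
      where
      disj = ccw-disjoint O ccw-i ccw-j i≢j
      αO' = flip-square-α O disj αO αOi αOj

    cw-square : ∀ O {i j} → IsαOrientation G α O → IsαOrientation G α (flip G O i) →
      IsαOrientation G α (flip G O j) → IsCW O i → IsCW O j → i ≢ j → i ∉ I → j ∉ I →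
      ∃ λ O' → DEdgeMinus G α I O' (flip G O i) j × DEdgeMinus G α I O' (flip G O j) i
    cw-square O {i} {j} αO αOi αOj cw-i cw-j i≢j i∉I j∉I =
      O' ,
      ((αO' , αOi , cw-flip (flip G O i) (cw-flip-disjoint O (edgeDisjoint-sym disj) cw-j) ,
        sym (flip-involutive (flip G O i) j)) , j∉I) ,
      ((αO' , αOj , ccw-O'-i , flip-swap {flip G O j} {O'} O'≡) , i∉I)
      where
      O' = flip G (flip G O i) j
      O'≡ : O' ≡ flip G (flip G O j) i
      O'≡ = flip-comm O i j
      disj = cw-disjoint O cw-i cw-j i≢j
      αO' = flip-square-α O disj αO αOi αOj
      ccw-O'-i : IsCCW G O' i
      ccw-O'-i = subst (λ O'' → IsCCW G O'' i) (sym O'≡)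
                   (cw-flip (flip G O j) (cw-flip-disjoint O disj cw-i))

    flip-UColoring : IsUColoring (DEdgeMinus G α I)
    flip-UColoring _ O _ i j O₁≢O₂
      ((αO , αO₁ , ccw-i , refl) , i∉I) ((_ , αO₂ , ccw-j , refl) , j∉I) =
      i≢j , ccw-square O αO αO₁ αO₂ ccw-i ccw-j i≢j i∉I j∉I
      where
      i≢j : i ≢ j
      i≢j refl = O₁≢O₂ refl

    flip-LColoring : IsLColoring (DEdgeMinus G α I)
    flip-LColoring O₁ O O₂ i j O₁≢O₂
      ((αO₁ , αO , ccw-i , O≡) , i∉I) ((αO₂ , _ , ccw-j , O≡') , j∉I)
      with refl ← flip-swap {O₁} {O} {i} O≡ | refl ← flip-swap {O₂} {O} {j} O≡' =
      i≢j , cw-square O αO αO₁ αO₂ cw-i cw-j i≢j i∉I j∉I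
      where
      i≢j : i ≢ j
      i≢j refl = O₁≢O₂ (trans (flip-swap O≡) (sym (flip-swap O≡')))
      cw-i = flip-target-cw O₁ O≡ ccw-i
      cw-j = flip-target-cw O₂ O≡' ccw-j

proposition4p3 : (G : EmbeddedGraph) (α : Fin (EmbeddedGraph.n G) → ℕ) →
    StronglyConnectedα G α → (I : Subset (EmbeddedGraph.k G)) →
    IsUColoring (DEdgeMinus G α I) × IsLColoring (DEdgeMinus G α I)
proposition4p3 G α _ I = flip-UColoring G α I , flip-LColoring G α I
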